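{- Let $C$ be a constraint and let $C_s(\vec{X},Z)$, defined as $m(\vec{X})\le Z$, be a soft constraint where $m$ is an open edit-based violation measure for $L_C$ with weights $\alpha,\beta,\gamma,\delta$ (for substitution, insertion, deletion, transposition respectively). Suppose $\min\{\alpha,\beta,\gamma\}\le\delta$. Then $C_s$ is contractible, i.e. for all sequences $\vec{X}$, variables $Y$ and values of $Z$, $C_s(\vec{X}Y,Z)\rightarrow C_s(\vec{X},Z)$.
   Context: The semantics of a constraint $C$ on sequences of variables is the language $L_C$ of words $d_1\cdots d_n$ such that $X_i=d_i$ is a solution of $C([X_1,\ldots,X_n])$. $P(L)=\{w\mid\exists u\; wu\in L\}$ is the prefix-closure of $L$. The edit operations on words are: substitute one letter for another, insert a letter, delete a letter, transpose two adjacent letters. Given non-negative weights $\alpha,\beta,\gamma,\delta$ (a weight may be effectively infinite), the open edit-based violation measure for a language $L$ is $m(w)=\min(\alpha n_s+\beta n_i+\gamma n_d+\delta n_t)$, minimized over all sequences of edits transforming $w$ into an element of $P(L)$, where $n_s,n_i,n_d,n_t$ count the substitutions, insertions, deletions and transpositions used.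
   Formalization: The weights α,β,γ,δ are non-negative rationals or ∞ rather than non-negative real numbers, and the values of Z are likewise rationals or ∞. -}

module Defs where

open import Data.Nat using (ℕ; zero; suc)
open import Data.Rational using (ℚ; 0ℚ; _+_; _⊓_) renaming (_≤_ to _≤ℚ_)
open import Data.List using (List; []; _∷_; _++_)
open import Data.Product using (∃; Σ; _×_; _,_)
open import Data.Sum using (_⊎_)
open import Data.Unit using (⊤)
open import Data.Empty using (⊥)
open import Relation.Binary.PropositionalEquality using (_≡_)

data ℚ∞ : Set where
  fin : ℚ → ℚ∞
  ∞   : ℚ∞

infixl 6 _+∞_
_+∞_ : ℚ∞ → ℚ∞ → ℚ∞
fin p +∞ fin q = fin (p + q)
fin _ +∞ ∞     = ∞
∞     +∞ _     = ∞

infix 4 _≤∞_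
data _≤∞_ : ℚ∞ → ℚ∞ → Set where
  fin≤fin : ∀ {p q} → p ≤ℚ q → fin p ≤∞ fin q
  _≤∞∞    : ∀ x → x ≤∞ ∞

_⊓∞_ : ℚ∞ → ℚ∞ → ℚ∞
fin p ⊓∞ fin q = fin (p ⊓ q)
fin p ⊓∞ ∞     = fin p
∞     ⊓∞ y     = y

-- n · x, with the convention 0 · ∞ = 0 (an edit of infinite weight
-- that is never used contributes nothing).
_·_ : ℕ → ℚ∞ → ℚ∞
zero  · x = fin 0ℚ
suc n · x = x +∞ (n · x)

NonNeg : ℚ∞ → Set
NonNeg (fin q) = 0ℚ ≤ℚ q
NonNeg ∞       = ⊤

Language : Set → Set₁
Language D = List D → Set

P : ∀ {D} → Language D → Language D
P L w = ∃ λ u → L (w ++ u)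

data Op : Set where
  S I Del T : Op

data Step {D : Set} : List D → List D → Op → Set where
  subst  : ∀ u a b v → Step (u ++ a ∷ v) (u ++ b ∷ v) S
  insert : ∀ u b v   → Step (u ++ v) (u ++ b ∷ v) I
  delete : ∀ u a v   → Step (u ++ a ∷ v) (u ++ v) Del
  transp : ∀ u a b v → Step (u ++ a ∷ b ∷ v) (u ++ b ∷ a ∷ v) T

record Counts : Set where
  constructor counts
  field ns ni nd nt : ℕ

bump : Op → Counts → Counts
bump S   (counts s i d t) = counts (suc s) i d t
bump I   (counts s i d t) = counts s (suc i) d t
bump Del (counts s i d t) = counts s i (suc d) t
bump T   (counts s i d t) = counts s i d (suc t)

data Edits {D : Set} : List D → List D → Counts → Set where
  done : ∀ {w} → Edits w w (counts 0 0 0 0)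
  step : ∀ {w w' w'' o c} → Step w w' o → Edits w' w'' c → Edits w w'' (bump o c)

record Weights : Set where
  field
    α β γ δ : ℚ∞
    α≥0 : NonNeg α
    β≥0 : NonNeg β
    γ≥0 : NonNeg γ
    δ≥0 : NonNeg δ

cost : Weights → Counts → ℚ∞
cost W (counts s i d t) =
  (s · Weights.α W) +∞ (i · Weights.β W) +∞ (d · Weights.γ W) +∞ (t · Weights.δ W)

-- IsOpenEditMeasure L W w v : v = m(w), i.e. v is the minimum of
-- α n_s + β n_i + γ n_d + δ n_t over all edit sequences transforming w
-- into an element of P(L) (the minimum of the empty set being ∞).
record IsOpenEditMeasure {D : Set} (L : Language D) (W : Weights)
                         (w : List D) (v : ℚ∞) : Set where
  field
    attained : v ≡ ∞ ⊎ Σ (List D) λ u → Σ Counts λ c →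
                 P L u × Edits w u c × cost W c ≡ v
    lower    : ∀ u c → P L u → Edits w u c → v ≤∞ cost W c

-- The soft constraint C_s(X⃗, Z) :  m(X⃗) ≤ Z.  Given the value m(w) = v
-- (witnessed by IsOpenEditMeasure), C_s holds of (w, z) iff v ≤ z.

-- Every edit turning w y into a word with a continuation in L can be replayed on the
-- prefix w, at no greater cost, so that the result is a prefix of the original result,
-- hence again a word of P(L). An edit lying beyond w is dropped and one lying inside w is
-- kept. The only edit that straddles the end of w is a transposition of its last letter
-- a with a following letter b; it is replaced by substituting b for a, inserting b before
-- a, or deleting a, and the cheapest of these costs min(α, β, γ) ≤ δ.
module Submission where

open import Defs
open import Data.List using (List; []; _∷_; _++_; _∷ʳ_)
open import Data.List.Properties using (++-assoc; ∷-injective)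
open import Data.Product using (∃; ∃₂; _×_; _,_)
open import Data.Sum using (_⊎_; inj₁; inj₂)
open import Data.Rational using (0ℚ)
import Data.Rational.Properties as ℚ
open import Relation.Binary.PropositionalEquality
  using (_≡_; refl; sym; trans; cong)
  renaming (subst to ≡-subst)

private
  variable
    D : Set

+∞-assoc : ∀ x y z → (x +∞ y) +∞ z ≡ x +∞ (y +∞ z)
+∞-assoc (fin p) (fin q) (fin r) = cong fin (ℚ.+-assoc p q r)
+∞-assoc (fin p) (fin q) ∞       = refl
+∞-assoc (fin p) ∞       z       = refl
+∞-assoc ∞       y       z       = refl

+∞-comm : ∀ x y → x +∞ y ≡ y +∞ x
+∞-comm (fin p) (fin q) = cong fin (ℚ.+-comm p q)
+∞-comm (fin p) ∞       = refl
+∞-comm ∞       (fin q) = refl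
+∞-comm ∞       ∞       = refl

+∞-identityˡ : ∀ x → fin 0ℚ +∞ x ≡ x
+∞-identityˡ (fin p) = cong fin (ℚ.+-identityˡ p)
+∞-identityˡ ∞       = refl

+∞-swap : ∀ x y z → x +∞ (y +∞ z) ≡ y +∞ (x +∞ z)
+∞-swap x y z = trans (sym (+∞-assoc x y z))
                      (trans (cong (_+∞ z) (+∞-comm x y)) (+∞-assoc y x z))

+∞-pullˡ : ∀ x {y y′} z → y′ ≡ x +∞ y → y′ +∞ z ≡ x +∞ (y +∞ z)
+∞-pullˡ x z refl = +∞-assoc x _ z

+∞-pullʳ : ∀ x {y y′} z → y′ ≡ x +∞ y → z +∞ y′ ≡ x +∞ (z +∞ y)
+∞-pullʳ x z refl = +∞-swap z x _

≤∞-refl : ∀ x → x ≤∞ x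
≤∞-refl (fin p) = fin≤fin ℚ.≤-refl
≤∞-refl ∞       = ∞ ≤∞∞

≤∞-reflexive : ∀ {x y} → x ≡ y → x ≤∞ y
≤∞-reflexive {x} refl = ≤∞-refl x

≤∞-trans : ∀ {x y z} → x ≤∞ y → y ≤∞ z → x ≤∞ z
≤∞-trans (fin≤fin p) (fin≤fin q) = fin≤fin (ℚ.≤-trans p q)
≤∞-trans _           (_ ≤∞∞)     = _ ≤∞∞

+∞-mono-≤∞ : ∀ {x x′ y y′} → x ≤∞ x′ → y ≤∞ y′ → x +∞ y ≤∞ x′ +∞ y′
+∞-mono-≤∞ (fin≤fin p) (fin≤fin q) = fin≤fin (ℚ.+-mono-≤ p q)
+∞-mono-≤∞ (fin≤fin p) (_ ≤∞∞)     = _ ≤∞∞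
+∞-mono-≤∞ (_ ≤∞∞)     _           = _ ≤∞∞

NonNeg⇒0≤∞ : ∀ {x} → NonNeg x → fin 0ℚ ≤∞ x
NonNeg⇒0≤∞ {fin q} 0≤q = fin≤fin 0≤q
NonNeg⇒0≤∞ {∞}     _   = _ ≤∞∞

x≤∞y+∞x : ∀ {y} x → NonNeg y → x ≤∞ y +∞ x
x≤∞y+∞x x y≥0 = ≤∞-trans (≤∞-reflexive (sym (+∞-identityˡ x)))
                         (+∞-mono-≤∞ (NonNeg⇒0≤∞ y≥0) (≤∞-refl x))

⊓∞-sel : ∀ x y → x ⊓∞ y ≡ x ⊎ x ⊓∞ y ≡ y
⊓∞-sel (fin p) (fin q) with ℚ.⊓-sel p q
... | inj₁ e = inj₁ (cong fin e)
... | inj₂ e = inj₂ (cong fin e)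
⊓∞-sel (fin p) ∞ = inj₁ refl
⊓∞-sel ∞       y = inj₂ refl

⊓∞-≤∞-sel : ∀ {x y z} → x ⊓∞ y ≤∞ z → x ≤∞ z ⊎ y ≤∞ z
⊓∞-≤∞-sel {x} {y} {z} h with ⊓∞-sel x y
... | inj₁ e = inj₁ (≡-subst (_≤∞ z) e h)
... | inj₂ e = inj₂ (≡-subst (_≤∞ z) e h)

infix 4 _⊑_
_⊑_ : List D → List D → Set
xs ⊑ ys = ∃ λ r → xs ++ r ≡ ys

[]⊑ : (xs : List D) → [] ⊑ xs
[]⊑ xs = xs , refl

⊑-++ʳ : ∀ {xs ys : List D} zs → xs ⊑ ys → xs ⊑ ys ++ zs
⊑-++ʳ {xs = xs} zs (r , refl) = r ++ zs , sym (++-assoc xs r zs)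

⊑-++⁺ˡ : ∀ (us : List D) {xs ys} → xs ⊑ ys → us ++ xs ⊑ us ++ ys
⊑-++⁺ˡ us {xs} (r , refl) = r , ++-assoc us xs r

P-⊑-closed : (L : Language D) {xs ys : List D} → xs ⊑ ys → P L ys → P L xs
P-⊑-closed L {xs} (r , refl) (v , Lv) = r ++ v , ≡-subst L (++-assoc xs r v) Lv

⊑-++-split : ∀ (x′ r u v : List D) → x′ ++ r ≡ u ++ v →
             x′ ⊑ u ⊎ ∃₂ λ b t → x′ ≡ u ++ b ∷ t × v ≡ b ∷ t ++ r
⊑-++-split []       r u       v e = inj₁ ([]⊑ u)
⊑-++-split (c ∷ x′) r []      v e = inj₂ (c , x′ , refl , sym e)
⊑-++-split (c ∷ x′) r (a ∷ u) v e with ∷-injective e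
... | refl , e′ with ⊑-++-split x′ r u v e′
...   | inj₁ x′⊑u             = inj₁ (⊑-++⁺ˡ (c ∷ []) x′⊑u)
...   | inj₂ (b , t , x′≡ , v≡) = inj₂ (b , t , cong (c ∷_) x′≡ , v≡)

module _ (W : Weights) where
  open Weights W

  weight : Op → ℚ∞
  weight S   = α
  weight I   = β
  weight Del = γ
  weight T   = δ

  weight-nonNeg : ∀ o → NonNeg (weight o)
  weight-nonNeg S   = α≥0
  weight-nonNeg I   = β≥0
  weight-nonNeg Del = γ≥0
  weight-nonNeg T   = δ≥0

  cost-bump : ∀ o c → cost W (bump o c) ≡ weight o +∞ cost W c
  cost-bump S   (counts s i d t) = +∞-pullˡ α _ (+∞-pullˡ α _ (+∞-pullˡ α _ refl))
  cost-bump I   (counts s i d t) = +∞-pullˡ β _ (+∞-pullˡ β _ (+∞-pullʳ β _ refl))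
  cost-bump Del (counts s i d t) = +∞-pullˡ γ _ (+∞-pullʳ γ _ refl)
  cost-bump T   (counts s i d t) = +∞-pullʳ δ _ refl

  cost≤∞cost-bump : ∀ o c → cost W c ≤∞ cost W (bump o c)
  cost≤∞cost-bump o c = ≤∞-trans (x≤∞y+∞x (cost W c) (weight-nonNeg o))
                                 (≤∞-reflexive (sym (cost-bump o c)))

  cost-bump-mono : ∀ o o′ c c′ → weight o′ ≤∞ weight o → cost W c′ ≤∞ cost W c →
                   cost W (bump o′ c′) ≤∞ cost W (bump o c)
  cost-bump-mono o o′ c c′ o′≤o c′≤c =
    ≤∞-trans (≤∞-reflexive (cost-bump o′ c′))
             (≤∞-trans (+∞-mono-≤∞ o′≤o c′≤c) (≤∞-reflexive (sym (cost-bump o c))))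

  cheaper-than-transposition : (α ⊓∞ β) ⊓∞ γ ≤∞ δ → α ≤∞ δ ⊎ β ≤∞ δ ⊎ γ ≤∞ δ
  cheaper-than-transposition h with ⊓∞-≤∞-sel h
  ... | inj₂ γ≤δ = inj₂ (inj₂ γ≤δ)
  ... | inj₁ αβ≤δ with ⊓∞-≤∞-sel αβ≤δ
  ...   | inj₁ α≤δ = inj₁ α≤δ
  ...   | inj₂ β≤δ = inj₂ (inj₁ β≤δ)

  ShadowStep : List D → List D → Op → Set
  ShadowStep {D} x′ x₁ o =
    ∃₂ λ (x₁′ : List D) o′ → Step x′ x₁′ o′ × weight o′ ≤∞ weight o × x₁′ ⊑ x₁

  shadow-inside : ∀ {x′ x₁′ x₁ : List D} {o} r →
                  Step x′ x₁′ o → x₁′ ++ r ≡ x₁ → ShadowStep x′ x₁ o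
  shadow-inside {o = o} r st e = _ , o , st , ≤∞-refl (weight o) , r , e

  module _ (min≤δ : (α ⊓∞ β) ⊓∞ γ ≤∞ δ) where

    shadow-straddling-transposition : ∀ (u : List D) a b v →
                                      ShadowStep (u ++ a ∷ []) (u ++ b ∷ a ∷ v) T
    shadow-straddling-transposition u a b v with cheaper-than-transposition min≤δ
    ... | inj₁ α≤δ =
      _ , S , subst u a b [] , α≤δ , ⊑-++⁺ˡ u (a ∷ v , refl)
    ... | inj₂ (inj₁ β≤δ) =
      _ , I , insert u b (a ∷ []) , β≤δ , ⊑-++⁺ˡ u (v , refl)
    ... | inj₂ (inj₂ γ≤δ) =
      _ , Del , delete u a [] , γ≤δ , ⊑-++⁺ˡ u ([]⊑ (b ∷ a ∷ v))

    shadow-step : ∀ {x x₁ x′ : List D} {o} →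
                  Step x x₁ o → x′ ⊑ x → x′ ⊑ x₁ ⊎ ShadowStep x′ x₁ o
    shadow-step (subst u a b v) (r , e) with ⊑-++-split _ r u (a ∷ v) e
    ... | inj₁ x′⊑u                   = inj₁ (⊑-++ʳ (b ∷ v) x′⊑u)
    ... | inj₂ (_ , t , refl , refl)  =
      inj₂ (shadow-inside r (subst u a b t) (++-assoc u (b ∷ t) r))
    shadow-step (insert u b v) (r , e) with ⊑-++-split _ r u v e
    ... | inj₁ x′⊑u                   = inj₁ (⊑-++ʳ (b ∷ v) x′⊑u)
    ... | inj₂ (c , t , refl , refl)  =
      inj₂ (shadow-inside r (insert u b (c ∷ t)) (++-assoc u (b ∷ c ∷ t) r))
    shadow-step (delete u a v) (r , e) with ⊑-++-split _ r u (a ∷ v) e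
    ... | inj₁ x′⊑u                   = inj₁ (⊑-++ʳ v x′⊑u)
    ... | inj₂ (_ , t , refl , refl)  =
      inj₂ (shadow-inside r (delete u a t) (++-assoc u t r))
    shadow-step (transp u a b v) (r , e) with ⊑-++-split _ r u (a ∷ b ∷ v) e
    ... | inj₁ x′⊑u                       = inj₁ (⊑-++ʳ (b ∷ a ∷ v) x′⊑u)
    ... | inj₂ (_ , _ ∷ t , refl , refl)  =
      inj₂ (shadow-inside r (transp u a b t) (++-assoc u (b ∷ a ∷ t) r))
    ... | inj₂ (_ , [] , refl , refl)     =
      inj₂ (shadow-straddling-transposition u a b v)

    shadow-edits : ∀ {x u x′ : List D} {c} → Edits x u c → x′ ⊑ x →
      ∃₂ λ u′ c′ → u′ ⊑ u × Edits x′ u′ c′ × cost W c′ ≤∞ cost W c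
    shadow-edits done x′⊑x = _ , _ , x′⊑x , done , ≤∞-refl _
    shadow-edits (step {o = o} {c = c} st es) x′⊑x with shadow-step st x′⊑x
    ... | inj₁ x′⊑x₁ with shadow-edits es x′⊑x₁
    ...   | u′ , c′ , u′⊑u , es′ , c′≤c =
      u′ , c′ , u′⊑u , es′ , ≤∞-trans c′≤c (cost≤∞cost-bump o c)
    shadow-edits (step {o = o} {c = c} st es) x′⊑x | inj₂ (_ , o′ , st′ , o′≤o , x₁′⊑x₁)
      with shadow-edits es x₁′⊑x₁
    ...   | u′ , c′ , u′⊑u , es′ , c′≤c =
      u′ , bump o′ c′ , u′⊑u , step st′ es′ ,
      cost-bump-mono o o′ c c′ o′≤o c′≤c

    openEditMeasure-mono : (L : Language D) →
      ∀ {x′ x m′ m} → x′ ⊑ x →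
      IsOpenEditMeasure L W x′ m′ → IsOpenEditMeasure L W x m → m′ ≤∞ m
    openEditMeasure-mono L x′⊑x M′ M with IsOpenEditMeasure.attained M
    ... | inj₁ refl = _ ≤∞∞
    ... | inj₂ (u , c , Pu , es , refl) with shadow-edits es x′⊑x
    ...   | u′ , c′ , u′⊑u , es′ , c′≤c =
      ≤∞-trans (IsOpenEditMeasure.lower M′ u′ c′ (P-⊑-closed L u′⊑u Pu) es′) c′≤c

theorem3 : {D : Set} (L : Language D) (W : Weights) →
    (Weights.α W ⊓∞ Weights.β W) ⊓∞ Weights.γ W ≤∞ Weights.δ W →
    (w : List D) (y : D) (z : ℚ∞) (m-w m-wy : ℚ∞) →
    IsOpenEditMeasure L W w m-w →
    IsOpenEditMeasure L W (w ∷ʳ y) m-wy →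
    m-wy ≤∞ z → m-w ≤∞ z
theorem3 L W h w y z m-w m-wy Mw Mwy m-wy≤z =
  ≤∞-trans (openEditMeasure-mono W h L (y ∷ [] , refl) Mw Mwy) m-wy≤z
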